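{- Let $p,q$ be positive integers. For every integer $\ell\ge 2$, letting $P_\ell$ be the path graph on $\ell$ vertices, \[ \hom(K_{p,q},P_\ell)=(\ell-2)(2^p+2^q-2)+2 . \] More generally, if $G$ is isomorphic to the direct product $P_{\ell_1}\times\cdots\times P_{\ell_k}$ of paths with $\ell_1,\dots,\ell_k\ge 2$, then \[ \hom(K_{p,q},G)=\prod_{j=1}^{k}\Bigl((\ell_j-2)(2^p+2^q-2)+2\Bigr). \]
   Context: $\hom(F,G)$ is the number of maps $\phi:V(F)\to V(G)$ sending every edge of $F$ to an edge of $G$. $K_{p,q}$ is the complete bipartite graph with partite sets of sizes $p$ and $q$. The direct (categorical/tensor) product $G_1\times G_2$ has vertex set $V(G_1)\times V(G_2)$, with $(i_1,i_2)$ adjacent to $(j_1,j_2)$ iff $\{i_1,j_1\}\in E(G_1)$ and $\{i_2,j_2\}\in E(G_2)$; for more factors it is defined iteratively. -}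

module Defs where

open import Data.Nat using (ℕ; zero; suc; _+_; _*_; _<ᵇ_; _≡ᵇ_)
open import Data.Bool using (Bool; true; false; _∧_; _xor_)
open import Data.Fin using (Fin; toℕ; remQuot)
open import Data.Fin.Properties using (all?)
open import Data.Vec using (Vec; []; _∷_; lookup)
open import Data.List using (List; []; _∷_; concatMap; map; length; filter; foldl; allFin)
open import Data.Product using (_×_; _,_; proj₁; proj₂)
open import Relation.Binary.PropositionalEquality using (_≡_)
open import Relation.Nullary using (Dec; yes; no)
open import Data.Bool.Properties using () renaming (_≟_ to _≟ᵇ_)
open import Function.Bundles using (_↔_; Inverse)

record Graph : Set where
  constructor mkGraph
  field
    V   : ℕ
    adj : Fin V → Fin V → Bool
open Graph public

IsHom : (F G : Graph) → (Fin (V F) → Fin (V G)) → Set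
IsHom F G φ = ∀ i j → adj F i j ≡ true → adj G (φ i) (φ j) ≡ true

isHom? : (F G : Graph) (φ : Fin (V F) → Fin (V G)) → Dec (IsHom F G φ)
isHom? F G φ = all? λ i → all? λ j → implies (adj F i j) (adj G (φ i) (φ j))
  where
  implies : (a b : Bool) → Dec (a ≡ true → b ≡ true)
  implies false b = yes (λ ())
  implies true b with b ≟ᵇ true
  ... | yes p = yes (λ _ → p)
  ... | no ¬p = no (λ f → ¬p (f _≡_.refl))

-- All maps Fin n → Fin m, each listed exactly once (as the vector of its values).
allVecs : (n m : ℕ) → List (Vec (Fin m) n)
allVecs zero m = [] ∷ []
allVecs (suc n) m = concatMap (λ x → map (x ∷_) (allVecs n m)) (allFin m)

hom : Graph → Graph → ℕ
hom F G = length (filter (λ v → isHom? F G (lookup v)) (allVecs (V F) (V G)))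

K : ℕ → ℕ → Graph
K p q = mkGraph (p + q) (λ i j → (toℕ i <ᵇ p) xor (toℕ j <ᵇ p))

P : ℕ → Graph
P ℓ = mkGraph ℓ (λ i j → (suc (toℕ i) ≡ᵇ toℕ j) Data.Bool.∨ (suc (toℕ j) ≡ᵇ toℕ i))

-- Direct (tensor) product; vertex set Fin (n * m) ≅ Fin n × Fin m via remQuot.
_⊗_ : Graph → Graph → Graph
G₁ ⊗ G₂ = mkGraph (V G₁ * V G₂) λ x y →
  let (a₁ , a₂) = remQuot (V G₂) x
      (b₁ , b₂) = remQuot (V G₂) y
  in adj G₁ a₁ b₁ ∧ adj G₂ a₂ b₂

pathProduct : ℕ → List ℕ → Graph
pathProduct ℓ₁ ℓs = foldl (λ G ℓ → G ⊗ P ℓ) (P ℓ₁) ℓs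

record _≅_ (G H : Graph) : Set where
  field
    bij      : Fin (V G) ↔ Fin (V H)
    preserve : ∀ i j → adj H (Inverse.to bij i) (Inverse.to bij j) ≡ adj G i j

prodL : List ℕ → ℕ
prodL = foldl _*_ 1

-- (ℓ-2)(2^p+2^q-2)+2  (only used with ℓ ≥ 2, p,q ≥ 1, so truncated subtraction is exact)
factor : ℕ → ℕ → ℕ → ℕ
factor p q ℓ = (ℓ Data.Nat.∸ 2) * ((2 Data.Nat.^ p + 2 Data.Nat.^ q) Data.Nat.∸ 2) + 2

{-# OPTIONS --safe #-}
-- A vertex map K_{p,q} → G is a pair of tuples xs ∈ V(G)^p, ys ∈ V(G)^q, and it is a
-- homomorphism iff every x_a is adjacent to every y_b.  If G has no 4-cycle, one of the two
-- tuples of such a pair is constant.  The pairs with xs constant number ∑ deg(x)^q, those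
-- with ys constant ∑ deg(y)^p and those with both constant ∑ deg(x), so by
-- inclusion–exclusion hom(K_{p,q}, G) = ∑ deg^p + ∑ deg^q − ∑ deg.  On P_ℓ the degrees are
-- 1, 2, …, 2, 1, which gives (ℓ−2)(2^p+2^q−2)+2.  The product formula follows because
-- hom(F, −) is invariant under isomorphism and turns direct products into products.
module Submission where

open import Defs
open import Data.Nat using (ℕ; _≤_)
open import Data.List using (List; _∷_; map)
open import Data.List.Relation.Unary.All using (All)
open import Data.Product using (_×_)
open import Relation.Binary.PropositionalEquality using (_≡_)

open import Data.Nat.Properties using (+-*-semiring)
open import Algebra.Properties.Semiring.Sum +-*-semiring
  using (sum; sum-syntax; sum-cong-≗; sum-replicate-zero; sum-init-last;
         ∑-distrib-+; ∑-comm; ∑-permute; *-distribˡ-sum; *-distribʳ-sum)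
open import Data.Bool using (Bool; true; false; _∧_; _∨_)
open import Data.Bool.Properties using (∧-comm; ∧-idem; ∨-comm)
open import Data.Empty using (⊥-elim)
open import Data.Fin using (Fin; zero; suc; toℕ; _↑ˡ_; _↑ʳ_; splitAt; combine; inject₁; fromℕ; _≟_)
open import Data.Fin.Properties
  using (toℕ<n; toℕ-inject₁; toℕ-fromℕ; toℕ-injective; remQuot-combine; splitAt⁻¹-↑ˡ; splitAt⁻¹-↑ʳ)
open import Data.List using ([]; filter; length; foldl; concatMap; allFin; tabulate) renaming (_++_ to _++ᴸ_)
open import Data.List.Properties using (map-++; map-∘; map-cong-local)
open import Data.List.Relation.Unary.All using ([]; _∷_)
import Data.List.Relation.Unary.All as All
open import Data.Nat using (zero; suc; _+_; _*_; _^_; _∸_; _<ᵇ_; _≡ᵇ_; s≤s; z≤n)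
import Data.Nat.ListAction as List
open import Data.Nat.ListAction.Properties using (sum-++)
open import Data.Nat.Properties
  using (+-identityʳ; +-assoc; +-comm; *-identityˡ; ^-zeroˡ; ^-identityʳ; m^n>0; +-mono-≤; m∸n+n≡m;
         +-cancelʳ-≡; _<?_; n≮n; m<n⇒m<1+n)
import Data.Nat.Properties as ℕ
open import Data.Nat.Tactic.RingSolver using (solve-∀)
open import Data.Product using (_,_; proj₁; proj₂; ∃)
open import Data.Sum using (_⊎_; inj₁; inj₂; [_,_]′) renaming (map to map-⊎)
open import Data.Vec using (Vec; []; _∷_; lookup; head; _++_; zipWith) renaming (map to mapᵛ)
open import Data.Vec.Properties using (lookup-++ˡ; lookup-++ʳ; lookup-zipWith; lookup-map)
open import Function using (_∘_; id; _⇔_; mk⇔; Equivalence; Inverse; _↔_)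
open import Relation.Binary.PropositionalEquality
  using (_≢_; refl; sym; trans; cong; cong₂; subst; subst₂; module ≡-Reasoning)
open import Relation.Nullary using (Dec; does; proof; ¬_)
open import Relation.Nullary.Decidable using (dec-true; dec-false; does-⇔; _×-dec_; _⊎-dec_)
open import Relation.Nullary.Reflects using (Reflects; invert)
open import Relation.Unary using (Decidable)

open ≡-Reasoning
open Equivalence using (to; from)

private
  variable
    A B : Set
    k l m n p q : ℕ

⟦_⟧ : Bool → ℕ
⟦ false ⟧ = 0
⟦ true  ⟧ = 1

⟦∧⟧ : ∀ a b → ⟦ a ∧ b ⟧ ≡ ⟦ a ⟧ * ⟦ b ⟧
⟦∧⟧ false b = refl
⟦∧⟧ true  b = sym (+-identityʳ ⟦ b ⟧)

⟦∧⟧-guarded : ∀ a {b c} → (a ≡ true → b ≡ c) → ⟦ a ∧ b ⟧ ≡ ⟦ a ⟧ * ⟦ c ⟧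
⟦∧⟧-guarded false b≡c = refl
⟦∧⟧-guarded true  b≡c = trans (cong ⟦_⟧ (b≡c refl)) (⟦∧⟧ true _)

⟦⟧-inclusion-exclusion : ∀ a b c → (c ≡ true → a ∨ b ≡ true) →
  ⟦ c ⟧ + ⟦ a ∧ (b ∧ c) ⟧ ≡ ⟦ a ∧ c ⟧ + ⟦ b ∧ c ⟧
⟦⟧-inclusion-exclusion true  true  c     _ = refl
⟦⟧-inclusion-exclusion true  false c     _ = refl
⟦⟧-inclusion-exclusion false true  c     _ = +-identityʳ ⟦ c ⟧
⟦⟧-inclusion-exclusion false false false _ = refl
⟦⟧-inclusion-exclusion false false true  c⇒a∨b with c⇒a∨b refl
... | ()

∧-≡-true : ∀ {a b} → a ∧ b ≡ true ⇔ (a ≡ true × b ≡ true)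
∧-≡-true {true}  = mk⇔ (refl ,_) proj₂
∧-≡-true {false} = mk⇔ (λ ()) (λ { (() , _) })

does-true⇒ : (a? : Dec A) → does a? ≡ true → A
does-true⇒ a? h = invert (subst (Reflects _) h (proof a?))

does-false⇒ : (a? : Dec A) → does a? ≡ false → ¬ A
does-false⇒ a? h = invert (subst (Reflects _) h (proof a?))

does-⇔-≡true : (a? : Dec A) {b : Bool} → A ⇔ (b ≡ true) → does a? ≡ b
does-⇔-≡true a? {true}  A⇔b = dec-true a? (from A⇔b refl)
does-⇔-≡true a? {false} A⇔b = dec-false a? ((λ ()) ∘ to A⇔b)

allᵇ : (A → Bool) → Vec A n → Bool
allᵇ f []       = true
allᵇ f (x ∷ xs) = f x ∧ allᵇ f xs

allᵇ-≡-true : (f : A → Bool) (xs : Vec A n) → allᵇ f xs ≡ true ⇔ (∀ i → f (lookup xs i) ≡ true)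
allᵇ-≡-true f xs = mk⇔ (⇒ xs) (⇐ xs)
  where
  ⇒ : (xs : Vec _ n) → allᵇ f xs ≡ true → ∀ i → f (lookup xs i) ≡ true
  ⇒ (x ∷ xs) h zero    = proj₁ (to ∧-≡-true h)
  ⇒ (x ∷ xs) h (suc i) = ⇒ xs (proj₂ (to ∧-≡-true h)) i
  ⇐ : (xs : Vec _ n) → (∀ i → f (lookup xs i) ≡ true) → allᵇ f xs ≡ true
  ⇐ []       h = refl
  ⇐ (x ∷ xs) h = from ∧-≡-true (h zero , ⇐ xs (h ∘ suc))

allᵇ-false⇒∃ : (f : A → Bool) (xs : Vec A n) → allᵇ f xs ≡ false → ∃ λ i → f (lookup xs i) ≡ false
allᵇ-false⇒∃ f (x ∷ xs) h with f x in fx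
... | false = zero , fx
... | true  = let i , fxᵢ = allᵇ-false⇒∃ f xs h in suc i , fxᵢ

allᵇ-cong : {f g : A → Bool} (xs : Vec A n) → (∀ x → f x ≡ g x) → allᵇ f xs ≡ allᵇ g xs
allᵇ-cong []       f≗g = refl
allᵇ-cong (x ∷ xs) f≗g = cong₂ _∧_ (f≗g x) (allᵇ-cong xs f≗g)

isConstant : Vec (Fin m) (suc k) → Bool
isConstant (x ∷ xs) = allᵇ (λ y → does (y ≟ x)) xs

allᵇ-isConstant : (f : Fin m → Bool) (v : Vec (Fin m) (suc k)) → isConstant v ≡ true → allᵇ f v ≡ f (head v)
allᵇ-isConstant f (x ∷ xs) const with f x in fx
... | false = refl
... | true  = from (allᵇ-≡-true f xs) λ i →
  trans (cong f (does-true⇒ (lookup xs i ≟ x) (to (allᵇ-≡-true _ xs) const i))) fx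

isConstant-false⇒ : (x : Fin m) (xs : Vec (Fin m) k) → isConstant (x ∷ xs) ≡ false → ∃ λ i → lookup xs i ≢ x
isConstant-false⇒ x xs h = let i , xᵢ≟x = allᵇ-false⇒∃ _ xs h in i , does-false⇒ (lookup xs i ≟ x) xᵢ≟x

-- Sums over Fin m and over Vec (Fin m) k

∑-const : ∀ n c → ∑[ i < n ] c ≡ n * c
∑-const zero    c = refl
∑-const (suc n) c = cong (c +_) (∑-const n c)

∑-δ : (x : Fin m) → ∑[ y < m ] ⟦ does (y ≟ x) ⟧ ≡ 1
∑-δ {suc m} zero = cong suc (sum-replicate-zero m)
∑-δ (suc x)      = ∑-δ x

∑-splitAt : ∀ m n (f : Fin (m + n) → ℕ) → sum f ≡ ∑[ i < m ] f (i ↑ˡ n) + ∑[ j < n ] f (m ↑ʳ j)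
∑-splitAt zero    n f = refl
∑-splitAt (suc m) n f = trans (cong (f zero +_) (∑-splitAt m n (f ∘ suc))) (sym (+-assoc (f zero) _ _))

∑-combine : ∀ m n (f : Fin (m * n) → ℕ) → sum f ≡ ∑[ i < m ] ∑[ j < n ] f (combine i j)
∑-combine zero    n f = refl
∑-combine (suc m) n f = trans (∑-splitAt n (m * n) f) (cong (∑[ j < n ] f (j ↑ˡ (m * n)) +_) (∑-combine m n _))

∑ᵛ : ∀ k → (Vec (Fin m) k → ℕ) → ℕ
∑ᵛ zero    f = f []
∑ᵛ (suc k) f = sum λ x → ∑ᵛ k (λ v → f (x ∷ v))

∑ᵛ-cong : ∀ k {f g : Vec (Fin m) k → ℕ} → (∀ v → f v ≡ g v) → ∑ᵛ k f ≡ ∑ᵛ k g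
∑ᵛ-cong zero    f≗g = f≗g []
∑ᵛ-cong (suc k) f≗g = sum-cong-≗ λ x → ∑ᵛ-cong k (λ v → f≗g (x ∷ v))

∑ᵛ-distrib-+ : ∀ k (f g : Vec (Fin m) k → ℕ) → ∑ᵛ k (λ v → f v + g v) ≡ ∑ᵛ k f + ∑ᵛ k g
∑ᵛ-distrib-+ zero    f g = refl
∑ᵛ-distrib-+ (suc k) f g = trans (sum-cong-≗ λ x → ∑ᵛ-distrib-+ k (λ v → f (x ∷ v)) (λ v → g (x ∷ v)))
  (∑-distrib-+ (λ x → ∑ᵛ k (λ v → f (x ∷ v))) (λ x → ∑ᵛ k (λ v → g (x ∷ v))))

*-distribˡ-∑ᵛ : ∀ k c (f : Vec (Fin m) k → ℕ) → c * ∑ᵛ k f ≡ ∑ᵛ k (λ v → c * f v)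
*-distribˡ-∑ᵛ zero    c f = refl
*-distribˡ-∑ᵛ (suc k) c f = trans (*-distribˡ-sum c λ x → ∑ᵛ k (λ v → f (x ∷ v)))
  (sum-cong-≗ λ x → *-distribˡ-∑ᵛ k c (λ v → f (x ∷ v)))

*-distribʳ-∑ᵛ : ∀ k c (f : Vec (Fin m) k → ℕ) → ∑ᵛ k f * c ≡ ∑ᵛ k (λ v → f v * c)
*-distribʳ-∑ᵛ zero    c f = refl
*-distribʳ-∑ᵛ (suc k) c f = trans (*-distribʳ-sum c λ x → ∑ᵛ k (λ v → f (x ∷ v)))
  (sum-cong-≗ λ x → *-distribʳ-∑ᵛ k c (λ v → f (x ∷ v)))

∑ᵛ-* : ∀ k l (f : Vec (Fin m) k → ℕ) (g : Vec (Fin n) l → ℕ) →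
  ∑ᵛ k f * ∑ᵛ l g ≡ ∑ᵛ k (λ u → ∑ᵛ l (λ w → f u * g w))
∑ᵛ-* k l f g = trans (*-distribʳ-∑ᵛ k _ f) (∑ᵛ-cong k λ u → *-distribˡ-∑ᵛ l (f u) g)

∑-∑ᵛ-comm : ∀ k (f : Fin n → Vec (Fin m) k → ℕ) → ∑[ i < n ] ∑ᵛ k (f i) ≡ ∑ᵛ k (λ v → ∑[ i < n ] f i v)
∑-∑ᵛ-comm zero    f = refl
∑-∑ᵛ-comm (suc k) f = trans (∑-comm λ i x → ∑ᵛ k (λ v → f i (x ∷ v)))
  (sum-cong-≗ λ x → ∑-∑ᵛ-comm k (λ i v → f i (x ∷ v)))

∑ᵛ-comm : ∀ k l (f : Vec (Fin m) k → Vec (Fin n) l → ℕ) →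
  ∑ᵛ k (λ u → ∑ᵛ l (f u)) ≡ ∑ᵛ l (λ w → ∑ᵛ k (λ u → f u w))
∑ᵛ-comm zero    l f = refl
∑ᵛ-comm (suc k) l f = trans (sum-cong-≗ λ x → ∑ᵛ-comm k l (λ u → f (x ∷ u)))
  (∑-∑ᵛ-comm l λ x w → ∑ᵛ k (λ u → f (x ∷ u) w))

∑ᵛ-++ : ∀ k l (f : Vec (Fin m) (k + l) → ℕ) → ∑ᵛ (k + l) f ≡ ∑ᵛ k (λ u → ∑ᵛ l (λ w → f (u ++ w)))
∑ᵛ-++ zero    l f = refl
∑ᵛ-++ (suc k) l f = sum-cong-≗ λ x → ∑ᵛ-++ k l (λ v → f (x ∷ v))

∑ᵛ-combine : ∀ {m n} k (f : Vec (Fin (m * n)) k → ℕ) →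
  ∑ᵛ k f ≡ ∑ᵛ k λ (us : Vec (Fin m) k) → ∑ᵛ k λ (ws : Vec (Fin n) k) → f (zipWith combine us ws)
∑ᵛ-combine         zero    f = refl
∑ᵛ-combine {m} {n} (suc k) f = begin
  ∑[ z < m * n ] ∑ᵛ k (λ v → f (z ∷ v))
    ≡⟨ ∑-combine m n (λ z → ∑ᵛ k (λ v → f (z ∷ v))) ⟩
  ∑[ i < m ] ∑[ j < n ] ∑ᵛ k (λ v → f (combine i j ∷ v))
    ≡⟨ sum-cong-≗ {m} (λ i → sum-cong-≗ {n} λ j → ∑ᵛ-combine {m} {n} k (λ v → f (combine i j ∷ v))) ⟩
  ∑[ i < m ] ∑[ j < n ] ∑ᵛ k (λ us → ∑ᵛ k (λ ws → f (combine i j ∷ zipWith (combine {m} {n}) us ws)))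
    ≡⟨ sum-cong-≗ {m} (λ i → ∑-∑ᵛ-comm k λ j us → ∑ᵛ k (λ ws → f (combine i j ∷ zipWith (combine {m} {n}) us ws))) ⟩
  ∑ᵛ (suc k) (λ us → ∑ᵛ (suc k) (λ ws → f (zipWith (combine {m} {n}) us ws))) ∎

∑ᵛ-permute : ∀ k (π : Fin m ↔ Fin n) (f : Vec (Fin n) k → ℕ) → ∑ᵛ k f ≡ ∑ᵛ k (f ∘ mapᵛ (Inverse.to π))
∑ᵛ-permute zero    π f = refl
∑ᵛ-permute (suc k) π f = trans (∑-permute _ π)
  (sum-cong-≗ λ x → ∑ᵛ-permute k π (λ v → f (Inverse.to π x ∷ v)))

∑ᵛ-allᵇ : ∀ k (f : Fin m → Bool) → ∑ᵛ k (λ v → ⟦ allᵇ f v ⟧) ≡ (∑[ x < m ] ⟦ f x ⟧) ^ k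
∑ᵛ-allᵇ zero    f = refl
∑ᵛ-allᵇ {m} (suc k) f = begin
  ∑[ x < m ] ∑ᵛ k (λ v → ⟦ f x ∧ allᵇ f v ⟧)
    ≡⟨ sum-cong-≗ (λ x → ∑ᵛ-cong k λ v → ⟦∧⟧ (f x) _) ⟩
  ∑[ x < m ] ∑ᵛ k (λ v → ⟦ f x ⟧ * ⟦ allᵇ f v ⟧)
    ≡⟨ sum-cong-≗ (λ x → *-distribˡ-∑ᵛ k ⟦ f x ⟧ (λ v → ⟦ allᵇ f v ⟧)) ⟨
  ∑[ x < m ] (⟦ f x ⟧ * ∑ᵛ k (λ v → ⟦ allᵇ f v ⟧))
    ≡⟨ sum-cong-≗ (λ x → cong (⟦ f x ⟧ *_) (∑ᵛ-allᵇ k f)) ⟩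
  ∑[ x < m ] (⟦ f x ⟧ * S ^ k)
    ≡⟨ *-distribʳ-sum (S ^ k) (⟦_⟧ ∘ f) ⟨
  S ^ suc k ∎
  where
  S = ∑[ x < m ] ⟦ f x ⟧

∑ᵛ-isConstant : ∀ k (g : Fin m → ℕ) → ∑ᵛ (suc k) (λ v → ⟦ isConstant v ⟧ * g (head v)) ≡ sum g
∑ᵛ-isConstant {m} k g = sum-cong-≗ λ x → begin
  ∑ᵛ k (λ v → ⟦ allᵇ (λ y → does (y ≟ x)) v ⟧ * g x)   ≡⟨ *-distribʳ-∑ᵛ k (g x) _ ⟨
  ∑ᵛ k (λ v → ⟦ allᵇ (λ y → does (y ≟ x)) v ⟧) * g x   ≡⟨ cong (_* g x) (∑ᵛ-allᵇ k _) ⟩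
  (∑[ y < m ] ⟦ does (y ≟ x) ⟧) ^ k * g x              ≡⟨ cong (λ s → s ^ k * g x) (∑-δ x) ⟩
  1 ^ k * g x                                          ≡⟨ cong (_* g x) (^-zeroˡ k) ⟩
  1 * g x                                              ≡⟨ *-identityˡ (g x) ⟩
  g x                                                  ∎

∑ᵛ-isConstant-allᵇ : ∀ k l (r : Fin m → Fin m → Bool) →
  ∑ᵛ (suc k) (λ xs → ∑ᵛ l (λ ys → ⟦ isConstant xs ⟧ * ⟦ allᵇ (r (head xs)) ys ⟧))
  ≡ ∑[ x < m ] ((∑[ y < m ] ⟦ r x y ⟧) ^ l)
∑ᵛ-isConstant-allᵇ {m} k l r = begin
  ∑ᵛ (suc k) (λ xs → ∑ᵛ l (λ ys → ⟦ isConstant xs ⟧ * ⟦ allᵇ (r (head xs)) ys ⟧))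
    ≡⟨ ∑ᵛ-cong (suc k) (λ xs → *-distribˡ-∑ᵛ l ⟦ isConstant xs ⟧ (λ ys → ⟦ allᵇ (r (head xs)) ys ⟧)) ⟨
  ∑ᵛ (suc k) (λ xs → ⟦ isConstant xs ⟧ * ∑ᵛ l (λ ys → ⟦ allᵇ (r (head xs)) ys ⟧))
    ≡⟨ ∑ᵛ-cong (suc k) (λ xs → cong (⟦ isConstant xs ⟧ *_) (∑ᵛ-allᵇ l (r (head xs)))) ⟩
  ∑ᵛ (suc k) (λ xs → ⟦ isConstant xs ⟧ * (∑[ y < m ] ⟦ r (head xs) y ⟧) ^ l)
    ≡⟨ ∑ᵛ-isConstant k (λ x → (∑[ y < m ] ⟦ r x y ⟧) ^ l) ⟩
  ∑[ x < m ] ((∑[ y < m ] ⟦ r x y ⟧) ^ l) ∎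

-- Counting homomorphisms

length-filter≡sum : {P : A → Set} (P? : Decidable P) (xs : List A) →
  length (filter P? xs) ≡ List.sum (map (⟦_⟧ ∘ does ∘ P?) xs)
length-filter≡sum P? []       = refl
length-filter≡sum P? (x ∷ xs) with does (P? x)
... | true  = cong suc (length-filter≡sum P? xs)
... | false = length-filter≡sum P? xs

sum-map-concatMap : (f : B → ℕ) (g : A → List B) (xs : List A) →
  List.sum (map f (concatMap g xs)) ≡ List.sum (map (List.sum ∘ map f ∘ g) xs)
sum-map-concatMap f g []       = refl
sum-map-concatMap f g (x ∷ xs) = begin
  List.sum (map f (g x ++ᴸ concatMap g xs))
    ≡⟨ cong List.sum (map-++ f (g x) _) ⟩
  List.sum (map f (g x) ++ᴸ map f (concatMap g xs))
    ≡⟨ sum-++ (map f (g x)) _ ⟩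
  List.sum (map f (g x)) + List.sum (map f (concatMap g xs))
    ≡⟨ cong (List.sum (map f (g x)) +_) (sum-map-concatMap f g xs) ⟩
  List.sum (map (List.sum ∘ map f ∘ g) (x ∷ xs)) ∎

sum-map-tabulate : (f : A → ℕ) (g : Fin n → A) → List.sum (map f (tabulate g)) ≡ ∑[ i < n ] f (g i)
sum-map-tabulate {n = zero}  f g = refl
sum-map-tabulate {n = suc n} f g = cong (f (g zero) +_) (sum-map-tabulate f (g ∘ suc))

sum-map-allVecs : ∀ k m (f : Vec (Fin m) k → ℕ) → List.sum (map f (allVecs k m)) ≡ ∑ᵛ k f
sum-map-allVecs zero    m f = +-identityʳ (f [])
sum-map-allVecs (suc k) m f = begin
  List.sum (map f (concatMap (λ x → map (x ∷_) (allVecs k m)) (allFin m)))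
    ≡⟨ sum-map-concatMap f _ (allFin m) ⟩
  List.sum (map (λ x → List.sum (map f (map (x ∷_) (allVecs k m)))) (allFin m))
    ≡⟨ sum-map-tabulate (λ x → List.sum (map f (map (x ∷_) (allVecs k m)))) id ⟩
  ∑[ x < m ] List.sum (map f (map (x ∷_) (allVecs k m)))
    ≡⟨ sum-cong-≗ (λ x → trans (cong List.sum (sym (map-∘ (allVecs k m))))
                                (sum-map-allVecs k m (λ v → f (x ∷ v)))) ⟩
  ∑ᵛ (suc k) f ∎

isHomᵇ : (F G : Graph) → Vec (Fin (V G)) (V F) → Bool
isHomᵇ F G v = does (isHom? F G (lookup v))

hom≡∑ᵛ : ∀ F G → hom F G ≡ ∑ᵛ (V F) (⟦_⟧ ∘ isHomᵇ F G)
hom≡∑ᵛ F G = trans (length-filter≡sum _ (allVecs (V F) (V G))) (sum-map-allVecs (V F) (V G) _)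

hom-resp-≅ : ∀ F {G H} → G ≅ H → hom F G ≡ hom F H
hom-resp-≅ F {G} {H} G≅H = begin
  hom F G                                           ≡⟨ hom≡∑ᵛ F G ⟩
  ∑ᵛ (V F) (⟦_⟧ ∘ isHomᵇ F G)                        ≡⟨ ∑ᵛ-cong (V F) (cong ⟦_⟧ ∘ isHomᵇ-map) ⟩
  ∑ᵛ (V F) (⟦_⟧ ∘ isHomᵇ F H ∘ mapᵛ (Inverse.to bij)) ≡⟨ ∑ᵛ-permute (V F) bij (⟦_⟧ ∘ isHomᵇ F H) ⟨
  ∑ᵛ (V F) (⟦_⟧ ∘ isHomᵇ F H)                        ≡⟨ hom≡∑ᵛ F H ⟨
  hom F H                                           ∎
  where
  open _≅_ G≅H
  adj-map : ∀ (v : Vec (Fin (V G)) (V F)) i j →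
    adj H (lookup (mapᵛ (Inverse.to bij) v) i) (lookup (mapᵛ (Inverse.to bij) v) j)
    ≡ adj G (lookup v i) (lookup v j)
  adj-map v i j = trans (cong₂ (adj H) (lookup-map i (Inverse.to bij) v) (lookup-map j (Inverse.to bij) v))
                        (preserve (lookup v i) (lookup v j))
  isHomᵇ-map : ∀ v → isHomᵇ F G v ≡ isHomᵇ F H (mapᵛ (Inverse.to bij) v)
  isHomᵇ-map v = does-⇔ (mk⇔ (λ h i j e → trans (adj-map v i j) (h i j e))
                              (λ h i j e → trans (sym (adj-map v i j)) (h i j e)))
                        (isHom? F G (lookup v)) (isHom? F H (lookup (mapᵛ (Inverse.to bij) v)))

adj-⊗-combine : ∀ G H (a c : Fin (V G)) (b d : Fin (V H)) →
  adj (G ⊗ H) (combine a b) (combine c d) ≡ adj G a c ∧ adj H b d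
adj-⊗-combine G H a c b d =
  cong₂ (λ (x y : Fin (V G) × Fin (V H)) → adj G (proj₁ x) (proj₁ y) ∧ adj H (proj₂ x) (proj₂ y))
        (remQuot-combine a b) (remQuot-combine c d)

isHom-⊗ : ∀ F G H (us : Vec (Fin (V G)) (V F)) (ws : Vec (Fin (V H)) (V F)) →
  IsHom F (G ⊗ H) (lookup (zipWith combine us ws)) ⇔ (IsHom F G (lookup us) × IsHom F H (lookup ws))
isHom-⊗ F G H us ws = mk⇔
  (λ h → (λ i j e → proj₁ (to ∧-≡-true (trans (sym (adj-lookup i j)) (h i j e))))
       , (λ i j e → proj₂ (to ∧-≡-true (trans (sym (adj-lookup i j)) (h i j e)))))
  (λ (hG , hH) i j e → trans (adj-lookup i j) (from ∧-≡-true (hG i j e , hH i j e)))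
  where
  adj-lookup : ∀ i j → adj (G ⊗ H) (lookup (zipWith combine us ws) i) (lookup (zipWith combine us ws) j)
                       ≡ adj G (lookup us i) (lookup us j) ∧ adj H (lookup ws i) (lookup ws j)
  adj-lookup i j =
    trans (cong₂ (adj (G ⊗ H)) (lookup-zipWith combine i us ws) (lookup-zipWith combine j us ws))
          (adj-⊗-combine G H _ _ _ _)

hom-⊗ : ∀ F G H → hom F (G ⊗ H) ≡ hom F G * hom F H
hom-⊗ F G H = begin
  hom F (G ⊗ H)
    ≡⟨ hom≡∑ᵛ F (G ⊗ H) ⟩
  ∑ᵛ (V F) (⟦_⟧ ∘ isHomᵇ F (G ⊗ H))
    ≡⟨ ∑ᵛ-combine (V F) _ ⟩
  ∑ᵛ (V F) (λ us → ∑ᵛ (V F) (λ ws → ⟦ isHomᵇ F (G ⊗ H) (zipWith combine us ws) ⟧))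
    ≡⟨ ∑ᵛ-cong (V F) (λ us → ∑ᵛ-cong (V F) (λ ws → isHomᵇ-⊗ us ws)) ⟩
  ∑ᵛ (V F) (λ us → ∑ᵛ (V F) (λ ws → ⟦ isHomᵇ F G us ⟧ * ⟦ isHomᵇ F H ws ⟧))
    ≡⟨ ∑ᵛ-* (V F) (V F) (⟦_⟧ ∘ isHomᵇ F G) (⟦_⟧ ∘ isHomᵇ F H) ⟨
  ∑ᵛ (V F) (⟦_⟧ ∘ isHomᵇ F G) * ∑ᵛ (V F) (⟦_⟧ ∘ isHomᵇ F H)
    ≡⟨ cong₂ _*_ (hom≡∑ᵛ F G) (hom≡∑ᵛ F H) ⟨
  hom F G * hom F H ∎
  where
  isHomᵇ-⊗ : ∀ us ws → ⟦ isHomᵇ F (G ⊗ H) (zipWith combine us ws) ⟧ ≡ ⟦ isHomᵇ F G us ⟧ * ⟦ isHomᵇ F H ws ⟧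
  isHomᵇ-⊗ us ws = trans (cong ⟦_⟧ (does-⇔ (isHom-⊗ F G H us ws) (isHom? F (G ⊗ H) _)
    (isHom? F G (lookup us) ×-dec isHom? F H (lookup ws)))) (⟦∧⟧ (isHomᵇ F G us) (isHomᵇ F H ws))

hom-foldl-⊗ : ∀ F (H : A → Graph) G₀ (as : List A) →
  hom F (foldl (λ G a → G ⊗ H a) G₀ as) ≡ foldl _*_ (hom F G₀) (map (hom F ∘ H) as)
hom-foldl-⊗ F H G₀ []       = refl
hom-foldl-⊗ F H G₀ (a ∷ as) = trans (hom-foldl-⊗ F H (G₀ ⊗ H a) as)
  (cong (λ h → foldl _*_ h (map (hom F ∘ H) as)) (hom-⊗ F G₀ (H a)))

-- Homomorphisms out of K p q

data Side p q : Fin (p + q) → Set where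
  left  : (a : Fin p) → Side p q (a ↑ˡ q)
  right : (b : Fin q) → Side p q (p ↑ʳ b)

side : ∀ p q (i : Fin (p + q)) → Side p q i
side p q i with splitAt p i in eq
... | inj₁ a = subst (Side p q) (splitAt⁻¹-↑ˡ eq) (left a)
... | inj₂ b = subst (Side p q) (splitAt⁻¹-↑ʳ eq) (right b)

<ᵇ-↑ˡ : ∀ q (a : Fin p) → (toℕ (a ↑ˡ q) <ᵇ p) ≡ true
<ᵇ-↑ˡ q zero    = refl
<ᵇ-↑ˡ q (suc a) = <ᵇ-↑ˡ q a

<ᵇ-↑ʳ : ∀ p (b : Fin q) → (toℕ (p ↑ʳ b) <ᵇ p) ≡ false
<ᵇ-↑ʳ zero    b = refl
<ᵇ-↑ʳ (suc p) b = <ᵇ-↑ʳ p b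

module _ (G : Graph) where

  private
    Vertex = Fin (V G)

  -- adj need not be symmetric, but K p q is: homomorphisms out of it only see this symmetric part.
  edge : Vertex → Vertex → Bool
  edge x y = adj G x y ∧ adj G y x

  deg : Vertex → ℕ
  deg x = ∑[ y < V G ] ⟦ edge x y ⟧

  allEdges : Vec Vertex p → Vec Vertex q → Bool
  allEdges xs ys = allᵇ (λ x → allᵇ (edge x) ys) xs

  edge-comm : ∀ x y → edge x y ≡ edge y x
  edge-comm x y = ∧-comm (adj G x y) (adj G y x)

  allEdges-≡-true : (xs : Vec Vertex p) (ys : Vec Vertex q) →
    allEdges xs ys ≡ true ⇔ (∀ a b → edge (lookup xs a) (lookup ys b) ≡ true)
  allEdges-≡-true xs ys = mk⇔
    (λ h a b → to (allᵇ-≡-true _ ys) (to (allᵇ-≡-true _ xs) h a) b)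
    (λ h → from (allᵇ-≡-true _ xs) λ a → from (allᵇ-≡-true _ ys) (h a))

  -- For loopless graphs such as P ℓ this says exactly that there is no 4-cycle.
  C₄-free : Set
  C₄-free = ∀ {x x′ y y′} → edge x y ≡ true → edge x y′ ≡ true → edge x′ y ≡ true → edge x′ y′ ≡ true →
    x ≡ x′ ⊎ y ≡ y′

  isHom-K : (xs : Vec Vertex p) (ys : Vec Vertex q) →
    IsHom (K p q) G (lookup (xs ++ ys)) ⇔ (∀ a b → edge (lookup xs a) (lookup ys b) ≡ true)
  isHom-K {p} {q} xs ys = mk⇔ ⇒ ⇐
    where
    ⇒ : IsHom (K p q) G (lookup (xs ++ ys)) → ∀ a b → edge (lookup xs a) (lookup ys b) ≡ true
    ⇒ h a b = from ∧-≡-true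
      ( subst₂ (λ x y → adj G x y ≡ true) (lookup-++ˡ xs ys a) (lookup-++ʳ xs ys b) (h _ _ K-ab)
      , subst₂ (λ x y → adj G x y ≡ true) (lookup-++ʳ xs ys b) (lookup-++ˡ xs ys a) (h _ _ K-ba) )
      where
      K-ab : adj (K p q) (a ↑ˡ q) (p ↑ʳ b) ≡ true
      K-ab rewrite <ᵇ-↑ˡ q a | <ᵇ-↑ʳ p b = refl
      K-ba : adj (K p q) (p ↑ʳ b) (a ↑ˡ q) ≡ true
      K-ba rewrite <ᵇ-↑ˡ q a | <ᵇ-↑ʳ p b = refl
    ⇐ : (∀ a b → edge (lookup xs a) (lookup ys b) ≡ true) → IsHom (K p q) G (lookup (xs ++ ys))
    ⇐ h i j with side p q i | side p q j
    ... | left a  | left a′ rewrite <ᵇ-↑ˡ q a | <ᵇ-↑ˡ q a′ = λ ()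
    ... | right b | right b′ rewrite <ᵇ-↑ʳ p b | <ᵇ-↑ʳ p b′ = λ ()
    ... | left a  | right b rewrite lookup-++ˡ xs ys a | lookup-++ʳ xs ys b = λ _ → proj₁ (to ∧-≡-true (h a b))
    ... | right b | left a  rewrite lookup-++ˡ xs ys a | lookup-++ʳ xs ys b = λ _ → proj₂ (to ∧-≡-true (h a b))

  hom-K : ∀ p q → hom (K p q) G ≡ ∑ᵛ p (λ xs → ∑ᵛ q (λ ys → ⟦ allEdges xs ys ⟧))
  hom-K p q = begin
    hom (K p q) G
      ≡⟨ hom≡∑ᵛ (K p q) G ⟩
    ∑ᵛ (p + q) (⟦_⟧ ∘ isHomᵇ (K p q) G)
      ≡⟨ ∑ᵛ-++ p q _ ⟩
    ∑ᵛ p (λ xs → ∑ᵛ q (λ ys → ⟦ isHomᵇ (K p q) G (xs ++ ys) ⟧))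
      ≡⟨ ∑ᵛ-cong p (λ xs → ∑ᵛ-cong q λ ys →
           cong ⟦_⟧ (does-⇔-≡true (isHom? (K p q) G _) (isHom⇔allEdges xs ys))) ⟩
    ∑ᵛ p (λ xs → ∑ᵛ q (λ ys → ⟦ allEdges xs ys ⟧)) ∎
    where
    isHom⇔allEdges : ∀ xs ys → IsHom (K p q) G (lookup (xs ++ ys)) ⇔ (allEdges xs ys ≡ true)
    isHom⇔allEdges xs ys = mk⇔ (from (allEdges-≡-true xs ys) ∘ to (isHom-K xs ys))
                               (from (isHom-K xs ys) ∘ to (allEdges-≡-true xs ys))

  allEdges-isConstantˡ : (xs : Vec Vertex (suc p)) (ys : Vec Vertex q) →
    isConstant xs ≡ true → allEdges xs ys ≡ allᵇ (edge (head xs)) ys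
  allEdges-isConstantˡ xs ys = allᵇ-isConstant (λ x → allᵇ (edge x) ys) xs

  allEdges-isConstantʳ : (xs : Vec Vertex p) (ys : Vec Vertex (suc q)) →
    isConstant ys ≡ true → allEdges xs ys ≡ allᵇ (edge (head ys)) xs
  allEdges-isConstantʳ xs ys const =
    allᵇ-cong xs λ x → trans (allᵇ-isConstant (edge x) ys const) (edge-comm x (head ys))

  C₄-free⇒isConstant : C₄-free → (xs : Vec Vertex (suc p)) (ys : Vec Vertex (suc q)) →
    allEdges xs ys ≡ true → isConstant xs ∨ isConstant ys ≡ true
  C₄-free⇒isConstant c₄ (x ∷ xs) (y ∷ ys) h with isConstant (x ∷ xs) in cx | isConstant (y ∷ ys) in cy
  ... | true  | _     = refl
  ... | false | true  = refl
  ... | false | false =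
    let i , xᵢ≢x = isConstant-false⇒ x xs cx
        j , yⱼ≢y = isConstant-false⇒ y ys cy
        e = to (allEdges-≡-true (x ∷ xs) (y ∷ ys)) h
    in ⊥-elim ([ xᵢ≢x ∘ sym , yⱼ≢y ∘ sym ]′
                 (c₄ (e zero zero) (e zero (suc j)) (e (suc i) zero) (e (suc i) (suc j))))

  hom-K-C₄-free : C₄-free → ∀ p q →
    hom (K (suc p) (suc q)) G + ∑[ x < V G ] deg x
    ≡ ∑[ x < V G ] (deg x ^ suc q) + ∑[ x < V G ] (deg x ^ suc p)
  hom-K-C₄-free c₄ p q = begin
    hom (K (suc p) (suc q)) G + ∑[ x < V G ] deg x
      ≡⟨ cong₂ _+_ (hom-K (suc p) (suc q)) (sym both-constant) ⟩
    S complete + S constant²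
      ≡⟨ S-+ complete constant² ⟨
    S (λ xs ys → complete xs ys + constant² xs ys)
      ≡⟨ ∑ᵛ-cong (suc p) (λ xs → ∑ᵛ-cong (suc q) λ ys →
           ⟦⟧-inclusion-exclusion (isConstant xs) (isConstant ys) _ (C₄-free⇒isConstant c₄ xs ys)) ⟩
    S (λ xs ys → constantˡ xs ys + constantʳ xs ys)
      ≡⟨ S-+ constantˡ constantʳ ⟩
    S constantˡ + S constantʳ
      ≡⟨ cong₂ _+_ left-constant right-constant ⟩
    ∑[ x < V G ] (deg x ^ suc q) + ∑[ x < V G ] (deg x ^ suc p) ∎
    where
    S : (Vec Vertex (suc p) → Vec Vertex (suc q) → ℕ) → ℕ
    S f = ∑ᵛ (suc p) λ xs → ∑ᵛ (suc q) (f xs)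

    S-+ : ∀ f g → S (λ xs ys → f xs ys + g xs ys) ≡ S f + S g
    S-+ f g = trans (∑ᵛ-cong (suc p) λ xs → ∑ᵛ-distrib-+ (suc q) (f xs) (g xs))
                    (∑ᵛ-distrib-+ (suc p) (λ xs → ∑ᵛ (suc q) (f xs)) (λ xs → ∑ᵛ (suc q) (g xs)))

    complete constantˡ constantʳ constant² : Vec Vertex (suc p) → Vec Vertex (suc q) → ℕ
    complete  xs ys = ⟦ allEdges xs ys ⟧
    constantˡ xs ys = ⟦ isConstant xs ∧ allEdges xs ys ⟧
    constantʳ xs ys = ⟦ isConstant ys ∧ allEdges xs ys ⟧
    constant² xs ys = ⟦ isConstant xs ∧ (isConstant ys ∧ allEdges xs ys) ⟧

    left-constant : S constantˡ ≡ ∑[ x < V G ] (deg x ^ suc q)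
    left-constant = trans
      (∑ᵛ-cong (suc p) λ xs → ∑ᵛ-cong (suc q) λ ys → ⟦∧⟧-guarded (isConstant xs) (allEdges-isConstantˡ xs ys))
      (∑ᵛ-isConstant-allᵇ p (suc q) edge)

    right-constant : S constantʳ ≡ ∑[ x < V G ] (deg x ^ suc p)
    right-constant = trans (∑ᵛ-comm (suc p) (suc q) constantʳ) (trans
      (∑ᵛ-cong (suc q) λ ys → ∑ᵛ-cong (suc p) λ xs → ⟦∧⟧-guarded (isConstant ys) (allEdges-isConstantʳ xs ys))
      (∑ᵛ-isConstant-allᵇ q (suc p) edge))

    both-constant : S constant² ≡ ∑[ x < V G ] deg x
    both-constant = begin
      S constant²
        ≡⟨ ∑ᵛ-cong (suc p) (λ xs → ∑ᵛ-cong (suc q) λ ys →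
             ⟦∧⟧-guarded (isConstant xs) (cong (isConstant ys ∧_) ∘ allEdges-isConstantˡ xs ys)) ⟩
      S (λ xs ys → ⟦ isConstant xs ⟧ * ⟦ isConstant ys ∧ allᵇ (edge (head xs)) ys ⟧)
        ≡⟨ ∑ᵛ-cong (suc p) (λ xs → ∑ᵛ-cong (suc q) λ ys →
             cong (⟦ isConstant xs ⟧ *_) (⟦∧⟧-guarded (isConstant ys) (allᵇ-isConstant (edge (head xs)) ys))) ⟩
      S (λ xs ys → ⟦ isConstant xs ⟧ * (⟦ isConstant ys ⟧ * ⟦ edge (head xs) (head ys) ⟧))
        ≡⟨ ∑ᵛ-cong (suc p) (λ xs → *-distribˡ-∑ᵛ (suc q) ⟦ isConstant xs ⟧ λ ys →
             ⟦ isConstant ys ⟧ * ⟦ edge (head xs) (head ys) ⟧) ⟨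
      ∑ᵛ (suc p) (λ xs → ⟦ isConstant xs ⟧ * ∑ᵛ (suc q) λ ys → ⟦ isConstant ys ⟧ * ⟦ edge (head xs) (head ys) ⟧)
        ≡⟨ ∑ᵛ-cong (suc p) (λ xs → cong (⟦ isConstant xs ⟧ *_) (∑ᵛ-isConstant q (λ y → ⟦ edge (head xs) y ⟧))) ⟩
      ∑ᵛ (suc p) (λ xs → ⟦ isConstant xs ⟧ * deg (head xs))
        ≡⟨ ∑ᵛ-isConstant p deg ⟩
      ∑[ x < V G ] deg x ∎

-- Paths

edge-P : ∀ ℓ (x y : Fin ℓ) → edge (P ℓ) x y ≡ adj (P ℓ) x y
edge-P ℓ x y = trans (cong (adj (P ℓ) x y ∧_) (∨-comm (suc (toℕ y) ≡ᵇ toℕ x) (suc (toℕ x) ≡ᵇ toℕ y)))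
                     (∧-idem (adj (P ℓ) x y))

_∼_ : ℕ → ℕ → Set
u ∼ w = suc u ≡ w ⊎ suc w ≡ u

adj-P⇒∼ : ∀ ℓ (x y : Fin ℓ) → adj (P ℓ) x y ≡ true → toℕ x ∼ toℕ y
adj-P⇒∼ ℓ x y = does-true⇒ ((suc (toℕ x) ℕ.≟ toℕ y) ⊎-dec (suc (toℕ y) ℕ.≟ toℕ x))

∼-C₄-free : ∀ {u u′ w w′} → u ∼ w → u ∼ w′ → u′ ∼ w → u′ ∼ w′ → u ≡ u′ ⊎ w ≡ w′
∼-C₄-free (inj₁ refl) _           (inj₁ refl) _           = inj₁ refl
∼-C₄-free (inj₂ refl) _           (inj₂ refl) _           = inj₁ refl
∼-C₄-free _           (inj₁ refl) _           (inj₁ refl) = inj₁ refl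
∼-C₄-free _           (inj₂ refl) _           (inj₂ refl) = inj₁ refl
∼-C₄-free (inj₁ refl) (inj₁ refl) _           _           = inj₂ refl
∼-C₄-free (inj₂ refl) (inj₂ refl) _           _           = inj₂ refl
∼-C₄-free (inj₁ refl) (inj₂ refl) (inj₂ refl) (inj₁ ())
∼-C₄-free (inj₂ refl) (inj₁ refl) (inj₁ refl) (inj₂ ())

P-C₄-free : ∀ ℓ → C₄-free (P ℓ)
P-C₄-free ℓ {x} {x′} {y} {y′} e₁ e₂ e₃ e₄ =
  map-⊎ toℕ-injective toℕ-injective (∼-C₄-free (∼ x y e₁) (∼ x y′ e₂) (∼ x′ y e₃) (∼ x′ y′ e₄))
  where
  ∼ : ∀ x y → edge (P ℓ) x y ≡ true → toℕ x ∼ toℕ y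
  ∼ x y e = adj-P⇒∼ ℓ x y (trans (sym (edge-P ℓ x y)) e)

⟦adj-P⟧ : ∀ u w → ⟦ (suc u ≡ᵇ w) ∨ (suc w ≡ᵇ u) ⟧ ≡ ⟦ w ≡ᵇ suc u ⟧ + ⟦ suc w ≡ᵇ u ⟧
⟦adj-P⟧ zero    zero          = refl
⟦adj-P⟧ zero    (suc zero)    = refl
⟦adj-P⟧ zero    (suc (suc w)) = refl
⟦adj-P⟧ (suc u) zero          = refl
⟦adj-P⟧ (suc u) (suc w)       = ⟦adj-P⟧ u w

∑-toℕ-≡ᵇ : ∀ ℓ c → ∑[ y < ℓ ] ⟦ toℕ y ≡ᵇ c ⟧ ≡ ⟦ c <ᵇ ℓ ⟧
∑-toℕ-≡ᵇ zero    c       = refl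
∑-toℕ-≡ᵇ (suc ℓ) zero    = cong suc (sum-replicate-zero ℓ)
∑-toℕ-≡ᵇ (suc ℓ) (suc c) = ∑-toℕ-≡ᵇ ℓ c

∑-suc-toℕ-≡ᵇ : ∀ ℓ (x : Fin ℓ) → ∑[ y < ℓ ] ⟦ suc (toℕ y) ≡ᵇ toℕ x ⟧ ≡ ⟦ 0 <ᵇ toℕ x ⟧
∑-suc-toℕ-≡ᵇ (suc ℓ) zero    = sum-replicate-zero (suc ℓ)
∑-suc-toℕ-≡ᵇ (suc ℓ) (suc x) =
  trans (∑-toℕ-≡ᵇ (suc ℓ) (toℕ x)) (cong ⟦_⟧ (dec-true (toℕ x <? suc ℓ) (m<n⇒m<1+n (toℕ<n x))))

deg-P : ∀ ℓ (x : Fin ℓ) → deg (P ℓ) x ≡ ⟦ suc (toℕ x) <ᵇ ℓ ⟧ + ⟦ 0 <ᵇ toℕ x ⟧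
deg-P ℓ x = begin
  ∑[ y < ℓ ] ⟦ edge (P ℓ) x y ⟧
    ≡⟨ sum-cong-≗ (λ y → trans (cong ⟦_⟧ (edge-P ℓ x y)) (⟦adj-P⟧ (toℕ x) (toℕ y))) ⟩
  ∑[ y < ℓ ] (⟦ toℕ y ≡ᵇ suc (toℕ x) ⟧ + ⟦ suc (toℕ y) ≡ᵇ toℕ x ⟧)
    ≡⟨ ∑-distrib-+ {ℓ} (λ y → ⟦ toℕ y ≡ᵇ suc (toℕ x) ⟧) (λ y → ⟦ suc (toℕ y) ≡ᵇ toℕ x ⟧) ⟩
  ∑[ y < ℓ ] ⟦ toℕ y ≡ᵇ suc (toℕ x) ⟧ + ∑[ y < ℓ ] ⟦ suc (toℕ y) ≡ᵇ toℕ x ⟧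
    ≡⟨ cong₂ _+_ (∑-toℕ-≡ᵇ ℓ (suc (toℕ x))) (∑-suc-toℕ-≡ᵇ ℓ x) ⟩
  ⟦ suc (toℕ x) <ᵇ ℓ ⟧ + ⟦ 0 <ᵇ toℕ x ⟧ ∎

∑-deg-P-^ : ∀ n k → ∑[ x < 2 + n ] (deg (P (2 + n)) x ^ k) ≡ 2 + n * 2 ^ k
∑-deg-P-^ n k = begin
  d zero ^ k + ∑[ i < suc n ] (d (suc i) ^ k)
    ≡⟨ cong (d zero ^ k +_) (sum-init-last (λ i → d (suc i) ^ k)) ⟩
  d zero ^ k + (∑[ i < n ] (d (suc (inject₁ i)) ^ k) + d (suc (fromℕ n)) ^ k)
    ≡⟨ cong₂ _+_ (cong (_^ k) (deg-P (2 + n) zero))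
                 (cong₂ _+_ (sum-cong-≗ λ i → cong (_^ k) (d-inner i)) (cong (_^ k) d-last)) ⟩
  1 ^ k + (∑[ i < n ] (2 ^ k) + 1 ^ k)
    ≡⟨ cong₂ (λ a b → a + (b + a)) (^-zeroˡ k) (∑-const n (2 ^ k)) ⟩
  1 + (n * 2 ^ k + 1)
    ≡⟨ cong suc (+-comm (n * 2 ^ k) 1) ⟩
  2 + n * 2 ^ k ∎
  where
  d = deg (P (2 + n))
  d-inner : ∀ i → d (suc (inject₁ i)) ≡ 2
  d-inner i = trans (deg-P (2 + n) (suc (inject₁ i)))
    (trans (cong (λ u → ⟦ u <ᵇ n ⟧ + 1) (toℕ-inject₁ i))
           (cong (λ b → ⟦ b ⟧ + 1) (dec-true (toℕ i <? n) (toℕ<n i))))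
  d-last : d (suc (fromℕ n)) ≡ 1
  d-last = trans (deg-P (2 + n) (suc (fromℕ n)))
    (trans (cong (λ u → ⟦ u <ᵇ n ⟧ + 1) (toℕ-fromℕ n))
           (cong (λ b → ⟦ b ⟧ + 1) (dec-false (n <? n) (n≮n n))))

factor-identity : ∀ n a b → 1 ≤ a → 1 ≤ b →
  n * ((a + b) ∸ 2) + 2 + (2 + n * 2) ≡ (2 + n * b) + (2 + n * a)
factor-identity n a b 1≤a 1≤b = begin
  n * ((a + b) ∸ 2) + 2 + (2 + n * 2) ≡⟨ regroup n ((a + b) ∸ 2) ⟩
  n * ((a + b) ∸ 2 + 2) + 4           ≡⟨ cong (λ s → n * s + 4) (m∸n+n≡m (+-mono-≤ 1≤a 1≤b)) ⟩
  n * (a + b) + 4                     ≡⟨ expand n a b ⟩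
  (2 + n * b) + (2 + n * a)           ∎
  where
  regroup : ∀ n d → n * d + 2 + (2 + n * 2) ≡ n * (d + 2) + 4
  regroup = solve-∀
  expand : ∀ n a b → n * (a + b) + 4 ≡ (2 + n * b) + (2 + n * a)
  expand = solve-∀

hom-K-P : 1 ≤ p → 1 ≤ q → ∀ ℓ → 2 ≤ ℓ → hom (K p q) (P ℓ) ≡ factor p q ℓ
hom-K-P {suc p} {suc q} (s≤s z≤n) (s≤s z≤n) (suc (suc n)) (s≤s (s≤s z≤n)) =
  +-cancelʳ-≡ (∑[ x < ℓ ] deg (P ℓ) x) _ _ (begin
    hom (K (suc p) (suc q)) (P ℓ) + ∑[ x < ℓ ] deg (P ℓ) x
      ≡⟨ hom-K-C₄-free (P ℓ) (P-C₄-free ℓ) p q ⟩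
    ∑[ x < ℓ ] (deg (P ℓ) x ^ suc q) + ∑[ x < ℓ ] (deg (P ℓ) x ^ suc p)
      ≡⟨ cong₂ _+_ (∑-deg-P-^ n (suc q)) (∑-deg-P-^ n (suc p)) ⟩
    (2 + n * 2 ^ suc q) + (2 + n * 2 ^ suc p)
      ≡⟨ factor-identity n (2 ^ suc p) (2 ^ suc q) (m^n>0 2 (suc p)) (m^n>0 2 (suc q)) ⟨
    factor (suc p) (suc q) ℓ + (2 + n * 2)
      ≡⟨ cong (factor (suc p) (suc q) ℓ +_) ∑-deg-P ⟨
    factor (suc p) (suc q) ℓ + ∑[ x < ℓ ] deg (P ℓ) x ∎)
  where
  ℓ = 2 + n
  ∑-deg-P : ∑[ x < ℓ ] deg (P ℓ) x ≡ 2 + n * 2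
  ∑-deg-P = trans (sum-cong-≗ λ x → sym (^-identityʳ (deg (P ℓ) x))) (∑-deg-P-^ n 1)

corollary4 : (p q : ℕ) → 1 ≤ p → 1 ≤ q →
    ((ℓ : ℕ) → 2 ≤ ℓ → hom (K p q) (P ℓ) ≡ factor p q ℓ)
    × ((ℓ₁ : ℕ) (ℓs : List ℕ) (G : Graph) → All (2 ≤_) (ℓ₁ ∷ ℓs) →
        G ≅ pathProduct ℓ₁ ℓs →
        hom (K p q) G ≡ prodL (map (factor p q) (ℓ₁ ∷ ℓs)))
corollary4 p q 1≤p 1≤q = hom-K-P 1≤p 1≤q , hom-K-pathProduct
  where
  hom-K-pathProduct : (ℓ₁ : ℕ) (ℓs : List ℕ) (G : Graph) → All (2 ≤_) (ℓ₁ ∷ ℓs) →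
    G ≅ pathProduct ℓ₁ ℓs → hom (K p q) G ≡ prodL (map (factor p q) (ℓ₁ ∷ ℓs))
  hom-K-pathProduct ℓ₁ ℓs G (2≤ℓ₁ ∷ 2≤ℓs) G≅ = begin
    hom (K p q) G
      ≡⟨ hom-resp-≅ (K p q) G≅ ⟩
    hom (K p q) (pathProduct ℓ₁ ℓs)
      ≡⟨ hom-foldl-⊗ (K p q) P (P ℓ₁) ℓs ⟩
    foldl _*_ (hom (K p q) (P ℓ₁)) (map (hom (K p q) ∘ P) ℓs)
      ≡⟨ cong₂ (foldl _*_) (trans (hom-K-P 1≤p 1≤q ℓ₁ 2≤ℓ₁) (sym (*-identityˡ _)))
                           (map-cong-local (All.map (hom-K-P 1≤p 1≤q _) 2≤ℓs)) ⟩
    prodL (map (factor p q) (ℓ₁ ∷ ℓs)) ∎
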